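{- (1) For each formula $\varphi$ of $\mathcal{L}_{\mathsf{D}}$ there exists a formula $\psi$ of $\mathcal{L}_{\mathsf{I}}$ such that for every SD-model $W$ and every $w\in W$, $W,w\models\varphi$ iff $W,w\models\psi$. (2) For each formula $\varphi$ of $\mathcal{D}$ there exists a formula $\psi$ of $\mathcal{I}$ such that for every SD-model $W$, $W\Vdash\varphi$ iff $W\Vdash\psi$.
   Context: Fix a countably infinite set $\mathit{PROP}$ of proposition symbols; assignments are maps $w:\mathit{PROP}\to\{0,1\}$; an SD-model is a (possibly empty) set $W$ of assignments. $\mathcal{L}_{\mathsf{D}}$: formulae $\varphi::=p\mid\neg\varphi\mid(\varphi\to\varphi)\mid\mathsf{D}(\varphi_1,\dots,\varphi_k;\psi)$ ($k\in\mathbb{N}$); $W,w\models p$ iff $w(p)=1$; $\neg,\to$ classical; $W,w\models\mathsf{D}(\varphi_1,\dots,\varphi_k;\psi)$ iff all $u,v\in W$ agreeing on the truth of each $\varphi_i$ agree on the truth of $\psi$. $\mathcal{L}_{\mathsf{I}}$: formulae $\varphi::=p\mid\neg\varphi\mid(\varphi\to\varphi)\mid(\varphi_1,\dots,\varphi_k)\,\mathsf{I}_{(\theta_1,\dots,\theta_m)}(\psi_1,\dots,\psi_n)$ ($k,n\ge1$, $m\ge0$), with $W,w\models(\varphi_1,\dots,\varphi_k)\,\mathsf{I}_{(\theta_1,\dots,\theta_m)}(\psi_1,\dots,\psi_n)$ iff for all $w_1,w_2\in W$ agreeing on the truth of each $\theta_i$ there is $v\in W$ agreeing with $w_1$ on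 the truth of each $\theta_i$ and $\varphi_i$ and with $w_2$ on the truth of each $\psi_i$; other clauses as for $\mathcal{L}_{\mathsf{D}}$. $\mathcal{D}$: formulae $\varphi::=p\mid\neg p\mid\mathsf{D}(p_1,\dots,p_k;q)\mid\neg\mathsf{D}(p_1,\dots,p_k;q)\mid(\varphi\vee\varphi)\mid(\varphi\wedge\varphi)$; $\mathcal{I}$: formulae $\varphi::=p\mid\neg p\mid(p_1,\dots,p_k)\,\mathsf{I}_{(r_1,\dots,r_m)}(q_1,\dots,q_n)\mid(\varphi\vee\varphi)\mid(\varphi\wedge\varphi)$ ($k,n\ge1$, $m\ge0$), all symbols in $\mathit{PROP}$. Team semantics: $W\Vdash p$ iff $w(p)=1$ for all $w\in W$; $W\Vdash\neg p$ iff $w(p)=0$ for all $w\in W$; $W\Vdash\varphi\wedge\psi$ iff both; $W\Vdash\varphi\vee\psi$ iff $W=U\cup V$ for some $U,V\subseteq W$ with $U\Vdash\varphi$, $V\Vdash\psi$; $W\Vdash\mathsf{D}(p_1,\dots,p_k;q)$ iff all $u,v\in W$ with $u(p_i)=v(p_i)$ for all $i$ have $u(q)=v(q)$; $W\Vdash\neg\mathsf{D}(p_1,\dots,p_k;q)$ iff $W=\emptyset$; $W\Vdash(p_1,\dots,p_k)\,\mathsf{I}_{(r_1,\dots,r_m)}(q_1,\dots,q_n)$ iff for all $w_1,w_2\in W$ agreeing on all $r_i$ there is $v\in W$ agreeing with $w_1$ on all $r_i,p_i$ and with $w_2$ on all $q_i$. -}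

module Defs where

open import Data.Nat using (ℕ)
open import Data.Bool using (Bool; true; false)
open import Data.List using (List; []; _∷_)
open import Data.List.NonEmpty using (List⁺; _∷_)
open import Data.Product using (Σ; _×_; _,_)
open import Data.Sum using (_⊎_)
open import Data.Empty using (⊥)
open import Relation.Nullary using (¬_)
open import Relation.Binary.PropositionalEquality using (_≡_)
open import Function.Bundles using (_⇔_)
open import Level using (Level) renaming (suc to lsuc)

PROP : Set
PROP = ℕ

Assignment : Set
Assignment = PROP → Bool

-- an SD-model is an arbitrary (possibly empty) set of assignments,
-- represented as a predicate on assignments
SDModel : Set₁
SDModel = Assignment → Set

data FormD : Set where
  atom : PROP → FormD
  neg  : FormD → FormD
  imp  : FormD → FormD → FormD
  dep  : List FormD → FormD → FormD

mutual
  satD : SDModel → Assignment → FormD → Set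
  satD W w (atom p)  = w p ≡ true
  satD W w (neg φ)   = ¬ satD W w φ
  satD W w (imp φ ψ) = satD W w φ → satD W w ψ
  satD W w (dep φs ψ) =
    ∀ u v → W u → W v → agreeD W u v φs → (satD W u ψ ⇔ satD W v ψ)

  agreeD : SDModel → Assignment → Assignment → List FormD → Set
  agreeD W u v []       = Data.Unit.⊤
    where import Data.Unit
  agreeD W u v (φ ∷ φs) = (satD W u φ ⇔ satD W v φ) × agreeD W u v φs

data FormI : Set where
  atom : PROP → FormI
  neg  : FormI → FormI
  imp  : FormI → FormI → FormI
  -- (φ₁,…,φₖ) I_(θ₁,…,θₘ) (ψ₁,…,ψₙ), k,n ≥ 1, m ≥ 0
  ind  : List⁺ FormI → List FormI → List⁺ FormI → FormI

mutual
  satI : SDModel → Assignment → FormI → Set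
  satI W w (atom p)  = w p ≡ true
  satI W w (neg φ)   = ¬ satI W w φ
  satI W w (imp φ ψ) = satI W w φ → satI W w ψ
  satI W w (ind φs θs ψs) =
    ∀ w₁ w₂ → W w₁ → W w₂ → agreeI W w₁ w₂ θs →
      Σ Assignment λ v → W v × agreeI W v w₁ θs × agreeI⁺ W v w₁ φs
                               × agreeI⁺ W v w₂ ψs

  agreeI : SDModel → Assignment → Assignment → List FormI → Set
  agreeI W u v []       = Data.Unit.⊤
    where import Data.Unit
  agreeI W u v (φ ∷ φs) = (satI W u φ ⇔ satI W v φ) × agreeI W u v φs

  agreeI⁺ : SDModel → Assignment → Assignment → List⁺ FormI → Set
  agreeI⁺ W u v (φ ∷ φs) = (satI W u φ ⇔ satI W v φ) × agreeI W u v φs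

data TeamD : Set where
  pos   : PROP → TeamD
  negp  : PROP → TeamD
  dep   : List PROP → PROP → TeamD
  ndep  : List PROP → PROP → TeamD
  _∨D_  : TeamD → TeamD → TeamD
  _∧D_  : TeamD → TeamD → TeamD

data TeamI : Set where
  pos   : PROP → TeamI
  negp  : PROP → TeamI
  ind   : List⁺ PROP → List PROP → List⁺ PROP → TeamI
  _∨I_  : TeamI → TeamI → TeamI
  _∧I_  : TeamI → TeamI → TeamI

AgreeP : Assignment → Assignment → List PROP → Set
AgreeP u v []       = Data.Unit.⊤
  where import Data.Unit
AgreeP u v (p ∷ ps) = u p ≡ v p × AgreeP u v ps

AgreeP⁺ : Assignment → Assignment → List⁺ PROP → Set
AgreeP⁺ u v (p ∷ ps) = u p ≡ v p × AgreeP u v ps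

_⊆_ : SDModel → SDModel → Set
U ⊆ W = ∀ w → U w → W w

IsSplit : SDModel → SDModel → SDModel → Set
IsSplit W U V = U ⊆ W × V ⊆ W × (∀ w → W w → U w ⊎ V w)

_⊩D_ : SDModel → TeamD → Set₁
W ⊩D pos p    = Level.Lift _ (∀ w → W w → w p ≡ true)
W ⊩D negp p   = Level.Lift _ (∀ w → W w → w p ≡ false)
W ⊩D dep ps q = Level.Lift _ (∀ u v → W u → W v → AgreeP u v ps → u q ≡ v q)
W ⊩D ndep ps q = Level.Lift _ (∀ w → ¬ W w)
W ⊩D (φ ∨D ψ) = Σ SDModel λ U → Σ SDModel λ V → Level.Lift (lsuc Level.zero) (IsSplit W U V) × U ⊩D φ × V ⊩D ψ
W ⊩D (φ ∧D ψ) = W ⊩D φ × W ⊩D ψ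

_⊩I_ : SDModel → TeamI → Set₁
W ⊩I pos p    = Level.Lift _ (∀ w → W w → w p ≡ true)
W ⊩I negp p   = Level.Lift _ (∀ w → W w → w p ≡ false)
W ⊩I ind ps rs qs = Level.Lift _
  (∀ w₁ w₂ → W w₁ → W w₂ → AgreeP w₁ w₂ rs →
     Σ Assignment λ v → W v × AgreeP v w₁ rs × AgreeP⁺ v w₁ ps × AgreeP⁺ v w₂ qs)
W ⊩I (φ ∨I ψ) = Σ SDModel λ U → Σ SDModel λ V → Level.Lift (lsuc Level.zero) (IsSplit W U V) × U ⊩I φ × V ⊩I ψ
W ⊩I (φ ∧I ψ) = W ⊩I φ × W ⊩I ψ

-- Dependence is the special case of independence in which the same formula
-- stands on both sides: some v agrees with w₁ on ψ and with w₂ on ψ exactly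
-- when w₁ and w₂ agree on ψ.  So D(φ̄; ψ) becomes (ψ) I_(φ̄) (ψ), the other
-- connectives are translated homomorphically, and ¬D(p̄; q), which holds only
-- in the empty team, becomes the contradiction p ∧ ¬p.
module Submission where

open import Defs
open import Data.Bool using (true; false)
open import Data.Empty using (⊥; ⊥-elim)
open import Data.List using (List; []; _∷_)
open import Data.List.NonEmpty using (_∷_)
open import Data.Product using (Σ; _×_; _,_)
open import Data.Product.Function.NonDependent.Propositional using (_×-⇔_)
open import Data.Unit using (tt)
open import Function.Bundles using (_⇔_; mk⇔; module Equivalence)
open import Function.Construct.Identity using (⇔-id)
open import Function.Construct.Symmetry using (⇔-sym)
open import Function.Construct.Composition using (_⇔-∘_)
open import Function.Related.TypeIsomorphisms using (→-cong-⇔; ¬-cong-⇔)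
open import Level using (lift)
open import Relation.Binary.PropositionalEquality using (_≡_; refl; sym; trans)

open Equivalence

⇔-cong : ∀ {A A′ B B′ : Set} → A ⇔ A′ → B ⇔ B′ → (A ⇔ B) ⇔ (A′ ⇔ B′)
⇔-cong A⇔A′ B⇔B′ = mk⇔
  (λ A⇔B → B⇔B′ ⇔-∘ (A⇔B ⇔-∘ ⇔-sym A⇔A′))
  (λ A′⇔B′ → ⇔-sym B⇔B′ ⇔-∘ (A′⇔B′ ⇔-∘ A⇔A′))

mutual
  toI : FormD → FormI
  toI (atom p)   = atom p
  toI (neg φ)    = neg (toI φ)
  toI (imp φ ψ)  = imp (toI φ) (toI ψ)
  toI (dep φs ψ) = ind (toI ψ ∷ []) (toIs φs) (toI ψ ∷ [])

  toIs : List FormD → List FormI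
  toIs []       = []
  toIs (φ ∷ φs) = toI φ ∷ toIs φs

agreeI-refl : ∀ W u (φs : List FormI) → agreeI W u u φs
agreeI-refl W u []       = tt
agreeI-refl W u (φ ∷ φs) = ⇔-id _ , agreeI-refl W u φs

selfIndependence⇔dependence :
  ∀ W w θs ψ →
  satI W w (ind (ψ ∷ []) θs (ψ ∷ [])) ⇔
  (∀ u v → W u → W v → agreeI W u v θs → (satI W u ψ ⇔ satI W v ψ))
selfIndependence⇔dependence W w θs ψ = mk⇔ dependent selfIndependent
  where
  dependent : satI W w (ind (ψ ∷ []) θs (ψ ∷ [])) →
              ∀ u v → W u → W v → agreeI W u v θs → (satI W u ψ ⇔ satI W v ψ)
  dependent indep u v Wu Wv u≈v with indep u v Wu Wv u≈v
  ... | _ , _ , _ , (x⇔u , _) , (x⇔v , _) = x⇔v ⇔-∘ ⇔-sym x⇔u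

  selfIndependent : (∀ u v → W u → W v → agreeI W u v θs → (satI W u ψ ⇔ satI W v ψ)) →
                    satI W w (ind (ψ ∷ []) θs (ψ ∷ []))
  selfIndependent determined w₁ w₂ W₁ W₂ w₁≈w₂ =
    w₁ , W₁ , agreeI-refl W w₁ θs , (⇔-id _ , tt) , (determined w₁ w₂ W₁ W₂ w₁≈w₂ , tt)

mutual
  satD⇔satI-toI : ∀ W w φ → satD W w φ ⇔ satI W w (toI φ)
  satD⇔satI-toI W w (atom p)   = ⇔-id _
  satD⇔satI-toI W w (neg φ)    = ¬-cong-⇔ (satD⇔satI-toI W w φ)
  satD⇔satI-toI W w (imp φ ψ)  = →-cong-⇔ (satD⇔satI-toI W w φ) (satD⇔satI-toI W w ψ)
  satD⇔satI-toI W w (dep φs ψ) =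
    ⇔-sym (selfIndependence⇔dependence W w (toIs φs) (toI ψ)) ⇔-∘ mk⇔
      (λ d u v Wu Wv u≈v → to (ψ-cong u v) (d u v Wu Wv (from (agreeD⇔agreeI-toIs W u v φs) u≈v)))
      (λ d u v Wu Wv u≈v → from (ψ-cong u v) (d u v Wu Wv (to (agreeD⇔agreeI-toIs W u v φs) u≈v)))
    where
    ψ-cong : ∀ u v → (satD W u ψ ⇔ satD W v ψ) ⇔ (satI W u (toI ψ) ⇔ satI W v (toI ψ))
    ψ-cong u v = ⇔-cong (satD⇔satI-toI W u ψ) (satD⇔satI-toI W v ψ)

  agreeD⇔agreeI-toIs : ∀ W u v φs → agreeD W u v φs ⇔ agreeI W u v (toIs φs)
  agreeD⇔agreeI-toIs W u v []       = ⇔-id _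
  agreeD⇔agreeI-toIs W u v (φ ∷ φs) =
    ⇔-cong (satD⇔satI-toI W u φ) (satD⇔satI-toI W v φ) ×-⇔ agreeD⇔agreeI-toIs W u v φs

toTeamI : TeamD → TeamI
toTeamI (pos p)     = pos p
toTeamI (negp p)    = negp p
toTeamI (dep ps q)  = ind (q ∷ []) ps (q ∷ [])
toTeamI (ndep ps q) = pos 0 ∧I negp 0
toTeamI (φ ∨D ψ)    = toTeamI φ ∨I toTeamI ψ
toTeamI (φ ∧D ψ)    = toTeamI φ ∧I toTeamI ψ

AgreeP-refl : ∀ u ps → AgreeP u u ps
AgreeP-refl u []       = tt
AgreeP-refl u (p ∷ ps) = refl , AgreeP-refl u ps

⊩D-dep⇔⊩I-selfIndependence : ∀ W ps q → W ⊩D dep ps q ⇔ W ⊩I ind (q ∷ []) ps (q ∷ [])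
⊩D-dep⇔⊩I-selfIndependence W ps q = mk⇔
  (λ (lift determined) → lift λ w₁ w₂ W₁ W₂ w₁≈w₂ →
     w₁ , W₁ , AgreeP-refl w₁ ps , (refl , tt) , (determined w₁ w₂ W₁ W₂ w₁≈w₂ , tt))
  (λ (lift indep) → lift λ u v Wu Wv u≈v → dependent u v (indep u v Wu Wv u≈v))
  where
  dependent : ∀ u v →
              Σ Assignment (λ x → W x × AgreeP x u ps × AgreeP⁺ x u (q ∷ []) × AgreeP⁺ x v (q ∷ [])) →
              u q ≡ v q
  dependent u v (_ , _ , _ , (x≡u , _) , (x≡v , _)) = trans (sym x≡u) x≡v

⊩D-ndep⇔⊩I-contradiction : ∀ W ps q p → W ⊩D ndep ps q ⇔ W ⊩I (pos p ∧I negp p)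
⊩D-ndep⇔⊩I-contradiction W ps q p = mk⇔
  (λ (lift empty) → lift (λ w Ww → ⊥-elim (empty w Ww)) , lift (λ w Ww → ⊥-elim (empty w Ww)))
  (λ (lift true-p , lift false-p) → lift λ w Ww → true≢false (trans (sym (true-p w Ww)) (false-p w Ww)))
  where
  true≢false : true ≡ false → ⊥
  true≢false ()

⊩D⇔⊩I-toTeamI : ∀ W φ → W ⊩D φ ⇔ W ⊩I toTeamI φ
⊩D⇔⊩I-toTeamI W (pos p)     = ⇔-id _
⊩D⇔⊩I-toTeamI W (negp p)    = ⇔-id _
⊩D⇔⊩I-toTeamI W (dep ps q)  = ⊩D-dep⇔⊩I-selfIndependence W ps q
⊩D⇔⊩I-toTeamI W (ndep ps q) = ⊩D-ndep⇔⊩I-contradiction W ps q 0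
⊩D⇔⊩I-toTeamI W (φ ∨D ψ)    = mk⇔
  (λ (U , V , split , Uφ , Vψ) → U , V , split , to (⊩D⇔⊩I-toTeamI U φ) Uφ , to (⊩D⇔⊩I-toTeamI V ψ) Vψ)
  (λ (U , V , split , Uφ , Vψ) → U , V , split , from (⊩D⇔⊩I-toTeamI U φ) Uφ , from (⊩D⇔⊩I-toTeamI V ψ) Vψ)
⊩D⇔⊩I-toTeamI W (φ ∧D ψ)    = ⊩D⇔⊩I-toTeamI W φ ×-⇔ ⊩D⇔⊩I-toTeamI W ψ

proposition4p3 :
  ((φ : FormD) → Σ FormI λ ψ →
     (W : SDModel) (w : Assignment) → W w → (satD W w φ ⇔ satI W w ψ))
  ×
  ((φ : TeamD) → Σ TeamI λ ψ →
     (W : SDModel) → (W ⊩D φ ⇔ W ⊩I ψ))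
proposition4p3 =
  (λ φ → toI φ , λ W w _ → satD⇔satI-toI W w φ) ,
  (λ φ → toTeamI φ , λ W → ⊩D⇔⊩I-toTeamI W φ)
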